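{- Let $\mathcal F$ be a union-closed family over the universe $[n]$ and let $0\le k\le n-1$. Then $\mathcal A_{n-k,n}\subseteq\overline{\mathcal F}^{(k)}$, where $\mathcal A_{m,n}=\{A\subseteq[n]:|A|=m\}$.
   Context: A family $\mathcal F$ of subsets of $[n]$ is union-closed over the universe $[n]$ if $[n]\in\mathcal F$ and $A\cup B\in\mathcal F$ for all $A,B\in\mathcal F$. Convention: the empty set is never a member of any family considered; $2^{[n]}$ denotes the family of all nonempty subsets of $[n]$. The closure of a union-closed $\mathcal F$ is $\overline{\mathcal F}=\{A\in 2^{[n]}:\ \mathcal F\cup\{A\}\text{ is union-closed}\}$; iterated closures are $\overline{\mathcal F}^{(0)}=\mathcal F$, $\overline{\mathcal F}^{(i)}=\overline{\overline{\mathcal F}^{(i-1)}}$. -}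

module Defs where

open import Data.Nat using (ℕ; zero; suc)
open import Data.Sum using (_⊎_)
open import Data.Product using (_×_)
open import Data.Fin.Subset using (Subset; ⊤; _∪_; Nonempty)
open import Relation.Binary.PropositionalEquality using (_≡_)

Family : ℕ → Set₁
Family n = Subset n → Set

-- Union-closed over the universe [n]: the empty set is never a member
-- (standing convention), [n] is a member, and closed under pairwise unions.
UnionClosed : (n : ℕ) → Family n → Set
UnionClosed n F =
  ((X : Subset n) → F X → Nonempty X)
  × F ⊤
  × ((X Y : Subset n) → F X → F Y → F (X ∪ Y))

insert : {n : ℕ} → Family n → Subset n → Family n
insert F A X = F X ⊎ X ≡ A

closure : {n : ℕ} → Family n → Family n
closure {n} F A = Nonempty A × UnionClosed n (insert F A)

closureIter : {n : ℕ} → ℕ → Family n → Family n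
closureIter zero    F = F
closureIter (suc i) F = closure (closureIter i F)

module Submission where

-- The argument rests on one criterion (closure-intro): if G is union-closed
-- and A is nonempty, then A ∈ closure G as soon as X ∪ A ∈ G ∪ {A} for every
-- X ∈ G; the remaining unions in G ∪ {A} are A ∪ A = A and unions inside G.
-- From the criterion we get that G ⊆ closure G and that closure G is again
-- union-closed, hence so is every iterated closure of F.
--
-- The theorem is then proved for all sets of size ≥ n − k by induction on k.
-- For k = 0 such a set is [n] ∈ F.  For k + 1, let G be the k-th closure and
-- |A| ≥ n − (k+1) ≥ 1.  For X ∈ G, either X ∪ A = A, or X ∪ A strictly
-- contains A, so |X ∪ A| ≥ n − k and X ∪ A ∈ G by induction; the criterion
-- then puts A into closure G.

open import Defs
open import Data.Nat using (ℕ; _<_; _∸_)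
open import Data.Fin.Subset using (Subset; ∣_∣)
open import Relation.Binary.PropositionalEquality using (_≡_)

open import Data.Nat using (zero; suc; _≤_; z≤n; s≤s)
open import Data.Nat.Properties
  using (≤-refl; ≤-trans; ≤-antisym; ≤-reflexive; m<n⇒0<n∸m; <-irrefl; <⇒≤)
open import Data.Fin.Subset using (⊤; _∪_; Nonempty; inside; outside)
open import Data.Fin.Subset.Properties
  using (nonempty?; Empty-unique; ∣⊥∣≡0; ∣p∣≤n; ∣p∣≡n⇒p≡⊤; ∣q∣≤∣p∪q∣; p⊆p∪q;
         ∪-comm; ∪-idem; ∪-idempotentCommutativeMonoid)
import Algebra.Solver.IdempotentCommutativeMonoid as ∪-Solver
open import Data.Vec.Base using ([]; _∷_)
open import Data.Vec.Properties using (≡-dec)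
open import Data.Bool.Properties using (_≟_)
open import Data.Product using (_,_; proj₁; proj₂)
open import Data.Sum using (inj₁; inj₂)
open import Data.Empty using (⊥-elim)
open import Relation.Nullary using (yes; no; ¬_)
open import Relation.Binary.PropositionalEquality
  using (refl; sym; trans; cong; subst; module ≡-Reasoning)

m∸n≤1+[m∸1+n] : ∀ m n → m ∸ n ≤ suc (m ∸ suc n)
m∸n≤1+[m∸1+n] zero    zero    = z≤n
m∸n≤1+[m∸1+n] zero    (suc n) = z≤n
m∸n≤1+[m∸1+n] (suc m) zero    = ≤-refl
m∸n≤1+[m∸1+n] (suc m) (suc n) = m∸n≤1+[m∸1+n] m n

nonempty-of-positive-size : ∀ {n} (A : Subset n) → 0 < ∣ A ∣ → Nonempty A
nonempty-of-positive-size {n} A 0<∣A∣ with nonempty? A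
... | yes ne = ne
... | no empty = ⊥-elim (<-irrefl refl 0<0)
  where
  0<0 : 0 < 0
  0<0 = subst (0 <_) (trans (cong ∣_∣ (Empty-unique empty)) (∣⊥∣≡0 n)) 0<∣A∣

∪-grows-strictly : ∀ {n} (X A : Subset n) → ¬ (X ∪ A ≡ A) → ∣ A ∣ < ∣ X ∪ A ∣
∪-grows-strictly [] [] X∪A≢A = ⊥-elim (X∪A≢A refl)
∪-grows-strictly (inside ∷ X) (outside ∷ A) _ = s≤s (∣q∣≤∣p∪q∣ X A)
∪-grows-strictly (inside ∷ X) (inside ∷ A) X∪A≢A =
  s≤s (∪-grows-strictly X A (λ eq → X∪A≢A (cong (inside ∷_) eq)))
∪-grows-strictly (outside ∷ X) (inside ∷ A) X∪A≢A =
  s≤s (∪-grows-strictly X A (λ eq → X∪A≢A (cong (inside ∷_) eq)))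
∪-grows-strictly (outside ∷ X) (outside ∷ A) X∪A≢A =
  ∪-grows-strictly X A (λ eq → X∪A≢A (cong (outside ∷_) eq))

∪-exchange : ∀ {n} (X A B : Subset n) → X ∪ (A ∪ B) ≡ (X ∪ B) ∪ A
∪-exchange {n} = solve 3 (λ X A B → X ⊕ (A ⊕ B) ⊜ (X ⊕ B) ⊕ A) refl
  where open ∪-Solver (∪-idempotentCommutativeMonoid n) using (solve; _⊜_; _⊕_)

∪-absorbed : ∀ {n} (X A B : Subset n) → (X ∪ B) ∪ A ≡ A → A ∪ B ≡ A
∪-absorbed {n} X A B eq = begin
  A ∪ B             ≡⟨ cong (_∪ B) (sym eq) ⟩
  ((X ∪ B) ∪ A) ∪ B ≡⟨ solve 3 (λ X A B → ((X ⊕ B) ⊕ A) ⊕ B ⊜ (X ⊕ B) ⊕ A) refl X A B ⟩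
  (X ∪ B) ∪ A       ≡⟨ eq ⟩
  A                 ∎
  where
  open ≡-Reasoning
  open ∪-Solver (∪-idempotentCommutativeMonoid n) using (solve; _⊜_; _⊕_)

module _ {n : ℕ} where

  closure-intro : (G : Family n) → UnionClosed n G → (A : Subset n) → Nonempty A →
    ((X : Subset n) → G X → insert G A (X ∪ A)) → closure G A
  closure-intro G (nonemptyG , ⊤∈G , ∪∈G) A nonemptyA X∪A∈G+A =
    nonemptyA , nonempty , inj₁ ⊤∈G , ∪-closed
    where
    nonempty : (U : Subset n) → insert G A U → Nonempty U
    nonempty U (inj₁ U∈G) = nonemptyG U U∈G
    nonempty U (inj₂ refl) = nonemptyA
    ∪-closed : (U V : Subset n) → insert G A U → insert G A V → insert G A (U ∪ V)
    ∪-closed U V (inj₁ U∈G) (inj₁ V∈G) = inj₁ (∪∈G U V U∈G V∈G)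
    ∪-closed U V (inj₁ U∈G) (inj₂ refl) = X∪A∈G+A U U∈G
    ∪-closed U V (inj₂ refl) (inj₁ V∈G) = subst (insert G A) (∪-comm V A) (X∪A∈G+A V V∈G)
    ∪-closed U V (inj₂ refl) (inj₂ refl) = inj₂ (∪-idem A)

  ⊆-closure : (G : Family n) → UnionClosed n G → (A : Subset n) → G A → closure G A
  ⊆-closure G ucG@(nonemptyG , _ , ∪∈G) A A∈G =
    closure-intro G ucG A (nonemptyG A A∈G) (λ X X∈G → inj₁ (∪∈G X A X∈G A∈G))

  -- The closure of a union-closed family is closed under unions: for X ∈ G,
  -- X ∪ B is in G or equals B, and (X ∪ B) ∪ A is in G or equals A, which
  -- forces A ∪ B = A.
  closure-∪ : (G : Family n) → UnionClosed n G → (A B : Subset n) →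
    closure G A → closure G B → closure G (A ∪ B)
  closure-∪ G ucG A B (nonemptyA , _ , _ , ∪∈G+A) (_ , _ , _ , ∪∈G+B) =
    closure-intro G ucG (A ∪ B) nonemptyA∪B X∪A∪B∈G+A∪B
    where
    nonemptyA∪B : Nonempty (A ∪ B)
    nonemptyA∪B = proj₁ nonemptyA , p⊆p∪q B (proj₂ nonemptyA)
    X∪A∪B∈G+A∪B : (X : Subset n) → G X → insert G (A ∪ B) (X ∪ (A ∪ B))
    X∪A∪B∈G+A∪B X X∈G rewrite ∪-exchange X A B
      with ∪∈G+B X B (inj₁ X∈G) (inj₂ refl)
    ... | inj₂ X∪B≡B = inj₂ (trans (cong (_∪ A) X∪B≡B) (∪-comm B A))
    ... | inj₁ X∪B∈G with ∪∈G+A (X ∪ B) A (inj₁ X∪B∈G) (inj₂ refl)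
    ...   | inj₁ X∪B∪A∈G = inj₁ X∪B∪A∈G
    ...   | inj₂ X∪B∪A≡A = inj₂ (trans X∪B∪A≡A (sym (∪-absorbed X A B X∪B∪A≡A)))

  closure-unionClosed : (G : Family n) → UnionClosed n G → UnionClosed n (closure G)
  closure-unionClosed G ucG@(_ , ⊤∈G , _) =
    (λ A A∈closure → proj₁ A∈closure) , ⊆-closure G ucG ⊤ ⊤∈G , closure-∪ G ucG

  closureIter-unionClosed : (F : Family n) → UnionClosed n F →
    (k : ℕ) → UnionClosed n (closureIter k F)
  closureIter-unionClosed F ucF zero    = ucF
  closureIter-unionClosed F ucF (suc k) =
    closure-unionClosed (closureIter k F) (closureIter-unionClosed F ucF k)

  large-sets-in-closureIter : (F : Family n) → UnionClosed n F →
    (k : ℕ) → k < n → (A : Subset n) → n ∸ k ≤ ∣ A ∣ → closureIter k F A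
  large-sets-in-closureIter F (_ , ⊤∈F , _) zero _ A n≤∣A∣ =
    subst F (sym (∣p∣≡n⇒p≡⊤ (≤-antisym (∣p∣≤n A) n≤∣A∣))) ⊤∈F
  large-sets-in-closureIter F ucF (suc k) 1+k<n A n∸[1+k]≤∣A∣ =
    closure-intro G (closureIter-unionClosed F ucF k) A nonemptyA X∪A∈G+A
    where
    G : Family n
    G = closureIter k F
    nonemptyA : Nonempty A
    nonemptyA = nonempty-of-positive-size A (≤-trans (m<n⇒0<n∸m 1+k<n) n∸[1+k]≤∣A∣)
    -- a set strictly larger than A has size at least n − k
    X∪A∈G+A : (X : Subset n) → G X → insert G A (X ∪ A)
    X∪A∈G+A X _ with ≡-dec _≟_ (X ∪ A) A
    ... | yes X∪A≡A = inj₂ X∪A≡A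
    ... | no X∪A≢A = inj₁ (large-sets-in-closureIter F ucF k (<⇒≤ 1+k<n) (X ∪ A)
            (≤-trans (m∸n≤1+[m∸1+n] n k)
              (≤-trans (s≤s n∸[1+k]≤∣A∣) (∪-grows-strictly X A X∪A≢A))))

corollary1 : (n : ℕ) (F : Family n) → UnionClosed n F →
    (k : ℕ) → k < n →
    (A : Subset n) → ∣ A ∣ ≡ n ∸ k → closureIter k F A
corollary1 n F ucF k k<n A ∣A∣≡n∸k =
  large-sets-in-closureIter F ucF k k<n A (≤-reflexive (sym ∣A∣≡n∸k))
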